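{- Let $R$ be a commutative ring and $q\in R$ such that $R$ is $q$-torsion free and $qR$ is a prime ideal, and let $n,r$ be integers with $r>n/2$. For every $f\in\mathrm{Aut}(\mathbb{A}^1_{R/q^n})$, every $g\in K_{n,r}(R,q)$ and every $c\in R$, $$\mathrm{Ad}_f(c\cdot g)=c\cdot\mathrm{Ad}_f(g).$$
   Context: For a commutative ring $B$, $\mathrm{Aut}(\mathbb{A}^1_B)$ denotes the group of polynomials $f\in B[T]$ invertible under composition, with group law composition. $K_{n,r}(R,q)=\{g\in\mathrm{Aut}(\mathbb{A}^1_{R/q^n}): g(T)\equiv T\bmod q^r\}$, the kernel of reduction to $\mathrm{Aut}(\mathbb{A}^1_{R/q^r})$. The adjoint action is $\mathrm{Ad}_f(g)=f\circ g\circ f^{ -1}$. The $R$-multiplication on $K_{n,r}(R,q)$ is defined by $c\cdot(T+q^rh(T)):=T+q^r c\,h(T)$ for $g(T)=T+q^rh(T)$ and $c\in R$. -}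

module Defs where

open import Level using (_⊔_)
open import Algebra.Bundles using (CommutativeRing)
open import Data.List using (List; []; _∷_; map)
open import Data.Nat using (ℕ; zero; suc)
open import Data.Product using (∃; _×_)
open import Data.Sum using (_⊎_)
open import Relation.Nullary using (¬_)

-- Polynomials over a commutative ring R, represented as coefficient lists
-- (constant coefficient first).  Polynomials over R/m are represented by
-- lifts to R[T], with equality "coefficientwise congruent modulo m".
module Poly {c ℓ} (R : CommutativeRing c ℓ) where
  open CommutativeRing R public

  Pol : Set c
  Pol = List Carrier

  Divides : Carrier → Carrier → Set (c ⊔ ℓ)
  Divides a b = ∃ λ k → a * k ≈ b

  pow : Carrier → ℕ → Carrier
  pow a zero = 1#
  pow a (suc n) = a * pow a n

  coeff : Pol → ℕ → Carrier
  coeff [] _ = 0#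
  coeff (a ∷ p) zero = a
  coeff (a ∷ p) (suc i) = coeff p i

  _⊕_ : Pol → Pol → Pol
  [] ⊕ p' = p'
  (a ∷ p) ⊕ [] = a ∷ p
  (a ∷ p) ⊕ (b ∷ p') = (a + b) ∷ (p ⊕ p')

  scale : Carrier → Pol → Pol
  scale a = map (a *_)

  _⊛_ : Pol → Pol → Pol
  [] ⊛ p' = []
  (a ∷ p) ⊛ p' = scale a p' ⊕ (0# ∷ (p ⊛ p'))

  _∘ₚ_ : Pol → Pol → Pol
  [] ∘ₚ g = []
  (a ∷ p) ∘ₚ g = (a ∷ []) ⊕ (g ⊛ (p ∘ₚ g))

  X : Pol
  X = 0# ∷ 1# ∷ []

  _≡[mod_]_ : Pol → Carrier → Pol → Set (c ⊔ ℓ)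
  p ≡[mod m ] p' = ∀ i → Divides m (coeff p i - coeff p' i)

  IsAutMod : Carrier → Pol → Set (c ⊔ ℓ)
  IsAutMod m f = ∃ λ g → ((f ∘ₚ g) ≡[mod m ] X) × ((g ∘ₚ f) ≡[mod m ] X)

  TorsionFree : Carrier → Set (c ⊔ ℓ)
  TorsionFree q = ∀ x → q * x ≈ 0# → x ≈ 0#

  PrimePrincipal : Carrier → Set (c ⊔ ℓ)
  PrimePrincipal q = (¬ Divides q 1#) × (∀ a b → Divides q (a * b) → Divides q a ⊎ Divides q b)

  TplusQr : Carrier → ℕ → Pol → Pol
  TplusQr q r h = X ⊕ scale (pow q r) h

  -- g ∈ K_{n,r}(R,q), written as g = T + q^r h in (R/q^n)[T]
  InK : Carrier → ℕ → ℕ → Pol → Pol → Set (c ⊔ ℓ)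
  InK q n r g h = IsAutMod (pow q n) g × (g ≡[mod pow q n ] TplusQr q r h)

  -- c · (T + q^r h) := T + q^r c h
  smul : Carrier → ℕ → Carrier → Pol → Pol
  smul q r k h = TplusQr q r (scale k h)

module Submission where

-- Put u = q^r.  Since n < 2r, u² = 0 in R/qⁿ, so for every polynomial p
-- the Taylor expansion stops after the linear term:
--     p(T + u·a(T)) = p(T) + u·a(T)·p'(T)                    (mod qⁿ).
-- Composing with f⁻¹ on the right gives, for every a,
--     f ∘ (T + u·a) ∘ f⁻¹ = T + u·((a·f') ∘ f⁻¹),
-- an expression which is R-linear in a.  Comparing with the hypothesis
-- f ∘ g ∘ f⁻¹ = T + u·h' and cancelling T yields u·((h·f') ∘ f⁻¹) = u·h',
-- and multiplying by c gives the claim for c·g = T + u·c·h.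

open import Defs
open import Algebra.Bundles using (CommutativeRing)
open import Algebra.Structures using (IsCommutativeRing)
open import Data.List using ([]; _∷_)
open import Data.Nat using (ℕ; zero; suc; _≤_) renaming (_<_ to _<ℕ_; _+_ to _+ℕ_)
open import Data.Nat.Properties using (m≤n⇒∃[o]m+o≡n; <⇒≤)
open import Data.Product using (_,_; _×_; proj₁; proj₂)
open import Level using (_⊔_)
open import Relation.Binary.Core using (Rel)
open import Relation.Binary.Structures using (IsEquivalence)
open import Relation.Binary.Bundles using (Setoid)
open import Relation.Binary.PropositionalEquality using () renaming (refl to ≡-refl)

IsRingCongruence : ∀ {c ℓ ℓ'} (R : CommutativeRing c ℓ) →
                   Rel (CommutativeRing.Carrier R) ℓ' → Set (c ⊔ ℓ')
IsRingCongruence R _∼_ = IsCommutativeRing _∼_ _+_ _*_ -_ 0# 1#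
  where open CommutativeRing R

module Modulo {c ℓ} (R : CommutativeRing c ℓ) (m : CommutativeRing.Carrier R) where
  open Poly R using (Carrier; Divides; _≈_; _+_; _*_; -_; _-_; 0#)
  open CommutativeRing R using (refl; sym; trans; +-assoc; +-identityˡ; +-comm;
    +-identity; +-cong; +-congˡ; +-congʳ; -‿cong; -‿inverseˡ; -‿inverse;
    *-assoc; *-comm; *-identity; *-congʳ; distrib; distribˡ; zeroʳ;
    +-commutativeSemigroup; +-group; +-abelianGroup; ring)
  open import Algebra.Properties.Group +-group using (x≈y⇒x∙y⁻¹≈ε; ε⁻¹≈ε)
  open import Algebra.Properties.AbelianGroup +-abelianGroup using (⁻¹-anti-homo‿-; ⁻¹-∙-comm)
  open import Algebra.Properties.CommutativeSemigroup +-commutativeSemigroup using (interchange)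
  open import Algebra.Properties.Ring ring using (x[y-z]≈xy-xz; [y-z]x≈yx-zx; -‿distribʳ-*)

  mR-resp : ∀ {x y} → x ≈ y → Divides m x → Divides m y
  mR-resp x≈y (k , mk≈x) = k , trans mk≈x x≈y

  mR-0 : Divides m 0#
  mR-0 = 0# , zeroʳ m

  mR-+ : ∀ {x y} → Divides m x → Divides m y → Divides m (x + y)
  mR-+ (k , mk≈x) (l , ml≈y) = k + l , trans (distribˡ m k l) (+-cong mk≈x ml≈y)

  mR-neg : ∀ {x} → Divides m x → Divides m (- x)
  mR-neg (k , mk≈x) = - k , trans (sym (-‿distribʳ-* m k)) (-‿cong mk≈x)

  mR-*ʳ : ∀ {x} a → Divides m x → Divides m (x * a)
  mR-*ʳ a (k , mk≈x) = k * a , trans (sym (*-assoc m k a)) (*-congʳ mk≈x)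

  mR-*ˡ : ∀ {x} a → Divides m x → Divides m (a * x)
  mR-*ˡ {x} a d = mR-resp (*-comm x a) (mR-*ʳ a d)

  infix 4 _≋_
  _≋_ : Rel Carrier (c ⊔ ℓ)
  x ≋ y = Divides m (x - y)

  ≈⇒≋ : ∀ {x y} → x ≈ y → x ≋ y
  ≈⇒≋ x≈y = mR-resp (sym (x≈y⇒x∙y⁻¹≈ε x≈y)) mR-0

  mR⇒≋0 : ∀ {x} → Divides m x → x ≋ 0#
  mR⇒≋0 {x} = mR-resp (sym (trans (+-congˡ ε⁻¹≈ε) (proj₂ +-identity x)))

  ≋-isEquivalence : IsEquivalence _≋_
  ≋-isEquivalence = record
    { refl  = ≈⇒≋ refl
    ; sym   = λ {x} {y} d → mR-resp (⁻¹-anti-homo‿- x y) (mR-neg d)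
    ; trans = λ {x} {y} {z} d e → mR-resp (telescope x y z) (mR-+ d e)
    }
    where
    telescope : ∀ x y z → (x - y) + (y - z) ≈ x - z
    telescope x y z = trans (+-assoc x (- y) (y - z)) (+-congˡ (trans
      (sym (+-assoc (- y) y (- z))) (trans (+-congʳ (-‿inverseˡ y)) (+-identityˡ (- z)))))

  ≋-+-cong : ∀ {x x' y y'} → x ≋ x' → y ≋ y' → x + y ≋ x' + y'
  ≋-+-cong {x} {x'} {y} {y'} d e = mR-resp regroup (mR-+ d e)
    where
    regroup : (x - x') + (y - y') ≈ (x + y) - (x' + y')
    regroup = trans (interchange x (- x') y (- y')) (+-congˡ (⁻¹-∙-comm x' y'))

  ≋-neg-cong : ∀ {x y} → x ≋ y → - x ≋ - y
  ≋-neg-cong {x} {y} d = mR-resp (sym (⁻¹-∙-comm x (- y))) (mR-neg d)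

  ≋-*-cong : ∀ {x x' y y'} → x ≋ x' → y ≋ y' → x * y ≋ x' * y'
  ≋-*-cong {x} {x'} {y} {y'} d e = IsEquivalence.trans ≋-isEquivalence
    (mR-resp ([y-z]x≈yx-zx y x x') (mR-*ʳ y d))
    (mR-resp (x[y-z]≈xy-xz x' y y') (mR-*ˡ x' e))

  ≋-isRingCongruence : IsRingCongruence R _≋_
  ≋-isRingCongruence = record
    { isRing = record
      { +-isAbelianGroup = record
        { isGroup = record
          { isMonoid = record
            { isSemigroup = record
              { isMagma = record { isEquivalence = ≋-isEquivalence ; ∙-cong = ≋-+-cong }
              ; assoc = lift₃ +-assoc }
            ; identity = lift₁ (proj₁ +-identity) , lift₁ (proj₂ +-identity) }
          ; inverse = lift₁ (proj₁ -‿inverse) , lift₁ (proj₂ -‿inverse)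
          ; ⁻¹-cong = ≋-neg-cong }
        ; comm = lift₂ +-comm }
      ; *-cong = ≋-*-cong
      ; *-assoc = lift₃ *-assoc
      ; *-identity = lift₁ (proj₁ *-identity) , lift₁ (proj₂ *-identity)
      ; distrib = lift₃ (proj₁ distrib) , lift₃ (proj₂ distrib) }
    ; *-comm = lift₂ *-comm }
    where
    lift₁ : ∀ {F G : Carrier → Carrier} → (∀ x → F x ≈ G x) → ∀ x → F x ≋ G x
    lift₁ e x = ≈⇒≋ (e x)
    lift₂ : ∀ {F G : Carrier → Carrier → Carrier} →
            (∀ x y → F x y ≈ G x y) → ∀ x y → F x y ≋ G x y
    lift₂ e x y = ≈⇒≋ (e x y)
    lift₃ : ∀ {F G : Carrier → Carrier → Carrier → Carrier} →
            (∀ x y z → F x y z ≈ G x y z) → ∀ x y z → F x y z ≋ G x y z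
    lift₃ e x y z = ≈⇒≋ (e x y z)

module PolynomialsModulo {c ℓ ℓ'} (R : CommutativeRing c ℓ)
  {_∼_ : Rel (CommutativeRing.Carrier R) ℓ'} (∼-isRingCongruence : IsRingCongruence R _∼_) where
  open Poly R using (Pol; coeff; _⊕_; scale; _⊛_; _∘ₚ_; X)

  R/∼ : CommutativeRing c ℓ'
  R/∼ = record { isCommutativeRing = ∼-isRingCongruence }
  open CommutativeRing R/∼ hiding (zero)

  open import Algebra.Properties.CommutativeSemigroup +-commutativeSemigroup
    using (interchange)
  open import Algebra.Properties.CommutativeSemigroup *-commutativeSemigroup
    using (x∙yz≈y∙xz)
  open import Algebra.Properties.Group +-group using (∙-cancelˡ)

  infix 4 _≃_
  record _≃_ (p p' : Pol) : Set ℓ' where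
    constructor coeffwise
    field coeff-≈ : ∀ i → coeff p i ≈ coeff p' i
  open _≃_ public

  ≃-isEquivalence : IsEquivalence _≃_
  ≃-isEquivalence = record
    { refl  = coeffwise λ i → refl
    ; sym   = λ e → coeffwise λ i → sym (coeff-≈ e i)
    ; trans = λ e e' → coeffwise λ i → trans (coeff-≈ e i) (coeff-≈ e' i)
    }

  ≃-setoid : Setoid c ℓ'
  ≃-setoid = record { isEquivalence = ≃-isEquivalence }

  open IsEquivalence ≃-isEquivalence
    using () renaming (refl to ≃-refl; sym to ≃-sym; trans to ≃-trans)
  open import Relation.Binary.Reasoning.Setoid ≃-setoid

  coeff-⊕ : ∀ p p' i → coeff (p ⊕ p') i ≈ coeff p i + coeff p' i
  coeff-⊕ [] p' i = sym (+-identityˡ _)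
  coeff-⊕ (a ∷ p) [] i = sym (+-identityʳ _)
  coeff-⊕ (a ∷ p) (b ∷ p') zero = refl
  coeff-⊕ (a ∷ p) (b ∷ p') (suc i) = coeff-⊕ p p' i

  coeff-scale : ∀ a p i → coeff (scale a p) i ≈ a * coeff p i
  coeff-scale a [] i = sym (zeroʳ a)
  coeff-scale a (b ∷ p) zero = refl
  coeff-scale a (b ∷ p) (suc i) = coeff-scale a p i

  ∷-cong : ∀ {a b p p'} → a ≈ b → p ≃ p' → (a ∷ p) ≃ (b ∷ p')
  ∷-cong a≈b e = coeffwise λ where
    zero → a≈b
    (suc i) → coeff-≈ e i

  ∷-injective : ∀ {a b p p'} → (a ∷ p) ≃ (b ∷ p') → a ≈ b × p ≃ p'
  ∷-injective e = coeff-≈ e zero , coeffwise λ i → coeff-≈ e (suc i)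

  ∷-vanishes : ∀ {a p} → (a ∷ p) ≃ [] → a ≈ 0# × p ≃ []
  ∷-vanishes e = coeff-≈ e zero , coeffwise λ i → coeff-≈ e (suc i)

  [0]≃[] : (0# ∷ []) ≃ []
  [0]≃[] = coeffwise λ where
    zero → refl
    (suc i) → refl

  ⊕-cong : ∀ {p p' w w'} → p ≃ p' → w ≃ w' → (p ⊕ w) ≃ (p' ⊕ w')
  ⊕-cong {p} {p'} {w} {w'} e e' = coeffwise λ i →
    trans (coeff-⊕ p w i) (trans (+-cong (coeff-≈ e i) (coeff-≈ e' i)) (sym (coeff-⊕ p' w' i)))

  scale-cong : ∀ {a a' p p'} → a ≈ a' → p ≃ p' → scale a p ≃ scale a' p'
  scale-cong {a} {a'} {p} {p'} a≈a' e = coeffwise λ i →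
    trans (coeff-scale a p i) (trans (*-cong a≈a' (coeff-≈ e i)) (sym (coeff-scale a' p' i)))

  ⊕-identityʳ : ∀ p → (p ⊕ []) ≃ p
  ⊕-identityʳ p = coeffwise λ i → trans (coeff-⊕ p [] i) (+-identityʳ _)

  ⊕-comm : ∀ p w → (p ⊕ w) ≃ (w ⊕ p)
  ⊕-comm p w = coeffwise λ i →
    trans (coeff-⊕ p w i) (trans (+-comm _ _) (sym (coeff-⊕ w p i)))

  ⊕-assoc : ∀ p w v → ((p ⊕ w) ⊕ v) ≃ (p ⊕ (w ⊕ v))
  ⊕-assoc p w v = coeffwise λ i →
    trans (coeff-⊕ (p ⊕ w) v i) (trans (+-congʳ (coeff-⊕ p w i))
      (trans (+-assoc _ _ _) (sym (trans (coeff-⊕ p (w ⊕ v) i) (+-congˡ (coeff-⊕ w v i))))))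

  ⊕-interchange : ∀ p w v t → ((p ⊕ w) ⊕ (v ⊕ t)) ≃ ((p ⊕ v) ⊕ (w ⊕ t))
  ⊕-interchange p w v t = coeffwise λ i →
    trans (coeff-⊕ (p ⊕ w) (v ⊕ t) i) (trans (+-cong (coeff-⊕ p w i) (coeff-⊕ v t i))
      (trans (interchange _ _ _ _)
        (sym (trans (coeff-⊕ (p ⊕ v) (w ⊕ t) i) (+-cong (coeff-⊕ p v i) (coeff-⊕ w t i))))))

  ⊕-cancelˡ : ∀ p w w' → (p ⊕ w) ≃ (p ⊕ w') → w ≃ w'
  ⊕-cancelˡ p w w' e = coeffwise λ i → ∙-cancelˡ (coeff p i) _ _
    (trans (sym (coeff-⊕ p w i)) (trans (coeff-≈ e i) (coeff-⊕ p w' i)))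

  scale-distribˡ : ∀ a p w → scale a (p ⊕ w) ≃ (scale a p ⊕ scale a w)
  scale-distribˡ a p w = coeffwise λ i →
    trans (coeff-scale a (p ⊕ w) i) (trans (*-congˡ (coeff-⊕ p w i)) (trans (distribˡ a _ _)
      (sym (trans (coeff-⊕ (scale a p) (scale a w) i)
                  (+-cong (coeff-scale a p i) (coeff-scale a w i))))))

  scale-distribʳ : ∀ a b p → scale (a + b) p ≃ (scale a p ⊕ scale b p)
  scale-distribʳ a b p = coeffwise λ i →
    trans (coeff-scale (a + b) p i) (trans (distribʳ _ a b)
      (sym (trans (coeff-⊕ (scale a p) (scale b p) i)
                  (+-cong (coeff-scale a p i) (coeff-scale b p i)))))

  scale-assoc : ∀ a b p → scale a (scale b p) ≃ scale (a * b) p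
  scale-assoc a b p = coeffwise λ i →
    trans (coeff-scale a (scale b p) i) (trans (*-congˡ (coeff-scale b p i))
      (trans (sym (*-assoc a b _)) (sym (coeff-scale (a * b) p i))))

  scale-comm : ∀ a b p → scale a (scale b p) ≃ scale b (scale a p)
  scale-comm a b p = coeffwise λ i →
    trans (coeff-scale a (scale b p) i) (trans (*-congˡ (coeff-scale b p i))
      (trans (x∙yz≈y∙xz a b _)
        (sym (trans (coeff-scale b (scale a p) i) (*-congˡ (coeff-scale a p i))))))

  scale-zero : ∀ {a} p → a ≈ 0# → scale a p ≃ []
  scale-zero {a} p a≈0 = coeffwise λ i →
    trans (coeff-scale a p i) (trans (*-congʳ a≈0) (zeroˡ _))

  scale-one : ∀ p → scale 1# p ≃ p
  scale-one p = coeffwise λ i → trans (coeff-scale 1# p i) (*-identityˡ _)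

  shift-⊕ : ∀ p w → ((0# ∷ p) ⊕ (0# ∷ w)) ≃ (0# ∷ (p ⊕ w))
  shift-⊕ p w = ∷-cong (+-identityˡ 0#) ≃-refl

  shift-scale : ∀ a p → scale a (0# ∷ p) ≃ (0# ∷ scale a p)
  shift-scale a p = ∷-cong (zeroʳ a) ≃-refl

  ⊛-distribʳ : ∀ p p' w → ((p ⊕ p') ⊛ w) ≃ ((p ⊛ w) ⊕ (p' ⊛ w))
  ⊛-distribʳ [] p' w = ≃-refl
  ⊛-distribʳ (a ∷ p) [] w = ≃-sym (⊕-identityʳ _)
  ⊛-distribʳ (a ∷ p) (b ∷ p') w = begin
    scale (a + b) w ⊕ (0# ∷ ((p ⊕ p') ⊛ w))
      ≈⟨ ⊕-cong (scale-distribʳ a b w)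
                (≃-trans (∷-cong refl (⊛-distribʳ p p' w)) (≃-sym (shift-⊕ (p ⊛ w) (p' ⊛ w)))) ⟩
    (scale a w ⊕ scale b w) ⊕ ((0# ∷ (p ⊛ w)) ⊕ (0# ∷ (p' ⊛ w)))
      ≈⟨ ⊕-interchange (scale a w) (scale b w) (0# ∷ (p ⊛ w)) (0# ∷ (p' ⊛ w)) ⟩
    ((a ∷ p) ⊛ w) ⊕ ((b ∷ p') ⊛ w) ∎

  ⊛-distribˡ : ∀ w p p' → (w ⊛ (p ⊕ p')) ≃ ((w ⊛ p) ⊕ (w ⊛ p'))
  ⊛-distribˡ [] p p' = ≃-refl
  ⊛-distribˡ (c ∷ w) p p' = begin
    scale c (p ⊕ p') ⊕ (0# ∷ (w ⊛ (p ⊕ p')))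
      ≈⟨ ⊕-cong (scale-distribˡ c p p')
                (≃-trans (∷-cong refl (⊛-distribˡ w p p')) (≃-sym (shift-⊕ (w ⊛ p) (w ⊛ p')))) ⟩
    (scale c p ⊕ scale c p') ⊕ ((0# ∷ (w ⊛ p)) ⊕ (0# ∷ (w ⊛ p')))
      ≈⟨ ⊕-interchange (scale c p) (scale c p') (0# ∷ (w ⊛ p)) (0# ∷ (w ⊛ p')) ⟩
    ((c ∷ w) ⊛ p) ⊕ ((c ∷ w) ⊛ p') ∎

  ⊛-scaleˡ : ∀ a p w → (scale a p ⊛ w) ≃ scale a (p ⊛ w)
  ⊛-scaleˡ a [] w = ≃-refl
  ⊛-scaleˡ a (b ∷ p) w = begin
    scale (a * b) w ⊕ (0# ∷ (scale a p ⊛ w))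
      ≈⟨ ⊕-cong (≃-sym (scale-assoc a b w))
                (≃-trans (∷-cong refl (⊛-scaleˡ a p w)) (≃-sym (shift-scale a (p ⊛ w)))) ⟩
    scale a (scale b w) ⊕ scale a (0# ∷ (p ⊛ w))
      ≈⟨ scale-distribˡ a (scale b w) (0# ∷ (p ⊛ w)) ⟨
    scale a ((b ∷ p) ⊛ w) ∎

  ⊛-scaleʳ : ∀ w a p → (w ⊛ scale a p) ≃ scale a (w ⊛ p)
  ⊛-scaleʳ [] a p = ≃-refl
  ⊛-scaleʳ (c ∷ w) a p = begin
    scale c (scale a p) ⊕ (0# ∷ (w ⊛ scale a p))
      ≈⟨ ⊕-cong (scale-comm c a p)
                (≃-trans (∷-cong refl (⊛-scaleʳ w a p)) (≃-sym (shift-scale a (w ⊛ p)))) ⟩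
    scale a (scale c p) ⊕ scale a (0# ∷ (w ⊛ p))
      ≈⟨ scale-distribˡ a (scale c p) (0# ∷ (w ⊛ p)) ⟨
    scale a ((c ∷ w) ⊛ p) ∎

  ⊛-X : ∀ p → (X ⊛ p) ≃ (0# ∷ p)
  ⊛-X p = begin
    scale 0# p ⊕ (0# ∷ (scale 1# p ⊕ (0# ∷ [])))
      ≈⟨ ⊕-cong (scale-zero p refl) (∷-cong refl (⊕-cong (scale-one p) [0]≃[])) ⟩
    0# ∷ (p ⊕ [])
      ≈⟨ ∷-cong refl (⊕-identityʳ p) ⟩
    0# ∷ p ∎

  ⊛-shift : ∀ w p → (w ⊛ (0# ∷ p)) ≃ (0# ∷ (w ⊛ p))
  ⊛-shift [] p = ≃-sym [0]≃[]
  ⊛-shift (c ∷ w) p = begin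
    scale c (0# ∷ p) ⊕ (0# ∷ (w ⊛ (0# ∷ p)))
      ≈⟨ ⊕-cong (shift-scale c p) (∷-cong refl (⊛-shift w p)) ⟩
    (0# ∷ scale c p) ⊕ (0# ∷ (0# ∷ (w ⊛ p)))
      ≈⟨ shift-⊕ (scale c p) (0# ∷ (w ⊛ p)) ⟩
    0# ∷ ((c ∷ w) ⊛ p) ∎

  -- Multiplication is well defined over R/∼.  A left factor congruent to
  -- zero is treated separately, since [] and 0 ∷ [] are distinct lists.
  ⊛-zeroʳ : ∀ w → (w ⊛ []) ≃ []
  ⊛-zeroʳ [] = ≃-refl
  ⊛-zeroʳ (c ∷ w) = ≃-trans (∷-cong refl (⊛-zeroʳ w)) [0]≃[]

  ⊛-congʳ : ∀ w {p p'} → p ≃ p' → (w ⊛ p) ≃ (w ⊛ p')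
  ⊛-congʳ [] e = ≃-refl
  ⊛-congʳ (c ∷ w) e = ⊕-cong (scale-cong refl e) (∷-cong refl (⊛-congʳ w e))

  ⊛-vanishˡ : ∀ p w → p ≃ [] → (p ⊛ w) ≃ []
  ⊛-vanishˡ [] w e = ≃-refl
  ⊛-vanishˡ (a ∷ p) w e with ∷-vanishes e
  ... | a≈0 , p≃[] =
    ≃-trans (⊕-cong (scale-zero w a≈0) (∷-cong refl (⊛-vanishˡ p w p≃[]))) [0]≃[]

  ⊛-congˡ : ∀ {p p'} w → p ≃ p' → (p ⊛ w) ≃ (p' ⊛ w)
  ⊛-congˡ {[]} {[]} w e = ≃-refl
  ⊛-congˡ {[]} {b ∷ p'} w e = ≃-sym (⊛-vanishˡ (b ∷ p') w (≃-sym e))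
  ⊛-congˡ {a ∷ p} {[]} w e = ⊛-vanishˡ (a ∷ p) w e
  ⊛-congˡ {a ∷ p} {b ∷ p'} w e with ∷-injective e
  ... | a≈b , p≃p' = ⊕-cong (scale-cong a≈b ≃-refl) (∷-cong refl (⊛-congˡ w p≃p'))

  ∘-congʳ : ∀ p {g g'} → g ≃ g' → (p ∘ₚ g) ≃ (p ∘ₚ g')
  ∘-congʳ [] e = ≃-refl
  ∘-congʳ (a ∷ p) {g} {g'} e =
    ⊕-cong ≃-refl (≃-trans (⊛-congˡ (p ∘ₚ g) e) (⊛-congʳ g' (∘-congʳ p e)))

  ∘-vanishˡ : ∀ p g → p ≃ [] → (p ∘ₚ g) ≃ []
  ∘-vanishˡ [] g e = ≃-refl
  ∘-vanishˡ (a ∷ p) g e with ∷-vanishes e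
  ... | a≈0 , p≃[] = begin
    (a ∷ []) ⊕ (g ⊛ (p ∘ₚ g))
      ≈⟨ ⊕-cong (∷-cong a≈0 ≃-refl) (⊛-congʳ g (∘-vanishˡ p g p≃[])) ⟩
    (0# ∷ []) ⊕ (g ⊛ [])
      ≈⟨ ⊕-cong [0]≃[] (⊛-zeroʳ g) ⟩
    [] ∎

  ∘-congˡ : ∀ {p p'} g → p ≃ p' → (p ∘ₚ g) ≃ (p' ∘ₚ g)
  ∘-congˡ {[]} {[]} g e = ≃-refl
  ∘-congˡ {[]} {b ∷ p'} g e = ≃-sym (∘-vanishˡ (b ∷ p') g (≃-sym e))
  ∘-congˡ {a ∷ p} {[]} g e = ∘-vanishˡ (a ∷ p) g e
  ∘-congˡ {a ∷ p} {b ∷ p'} g e with ∷-injective e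
  ... | a≈b , p≃p' = ⊕-cong (∷-cong a≈b ≃-refl) (⊛-congʳ g (∘-congˡ g p≃p'))

  ∘-distrib : ∀ p p' g → ((p ⊕ p') ∘ₚ g) ≃ ((p ∘ₚ g) ⊕ (p' ∘ₚ g))
  ∘-distrib [] p' g = ≃-refl
  ∘-distrib (a ∷ p) [] g = ≃-sym (⊕-identityʳ _)
  ∘-distrib (a ∷ p) (b ∷ p') g = begin
    ((a ∷ []) ⊕ (b ∷ [])) ⊕ (g ⊛ ((p ⊕ p') ∘ₚ g))
      ≈⟨ ⊕-cong ≃-refl (≃-trans (⊛-congʳ g (∘-distrib p p' g))
                                (⊛-distribˡ g (p ∘ₚ g) (p' ∘ₚ g))) ⟩
    ((a ∷ []) ⊕ (b ∷ [])) ⊕ ((g ⊛ (p ∘ₚ g)) ⊕ (g ⊛ (p' ∘ₚ g)))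
      ≈⟨ ⊕-interchange (a ∷ []) (b ∷ []) (g ⊛ (p ∘ₚ g)) (g ⊛ (p' ∘ₚ g)) ⟩
    ((a ∷ p) ∘ₚ g) ⊕ ((b ∷ p') ∘ₚ g) ∎

  ∘-scale : ∀ a p g → (scale a p ∘ₚ g) ≃ scale a (p ∘ₚ g)
  ∘-scale a [] g = ≃-refl
  ∘-scale a (b ∷ p) g = begin
    scale a (b ∷ []) ⊕ (g ⊛ (scale a p ∘ₚ g))
      ≈⟨ ⊕-cong ≃-refl (≃-trans (⊛-congʳ g (∘-scale a p g)) (⊛-scaleʳ g a (p ∘ₚ g))) ⟩
    scale a (b ∷ []) ⊕ scale a (g ⊛ (p ∘ₚ g))
      ≈⟨ scale-distribˡ a (b ∷ []) (g ⊛ (p ∘ₚ g)) ⟨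
    scale a ((b ∷ p) ∘ₚ g) ∎

  deriv : Pol → Pol
  deriv [] = []
  deriv (b ∷ p) = p ⊕ (0# ∷ deriv p)

  Ad : Pol → Pol → Pol → Pol
  Ad f finv g = (f ∘ₚ g) ∘ₚ finv

  -- Throughout, u is a square-zero element of R/∼ (in the theorem, u = q^r).
  module SquareZero (u : Carrier) (u²≈0 : u * u ≈ 0#) where

    absorb : ∀ a p A → scale u (a ⊛ (p ⊕ scale u A)) ≃ scale u (a ⊛ p)
    absorb a p A = begin
      scale u (a ⊛ (p ⊕ scale u A))
        ≈⟨ scale-cong refl (≃-trans (⊛-distribˡ a p (scale u A)) (⊕-cong ≃-refl (⊛-scaleʳ a u A))) ⟩
      scale u ((a ⊛ p) ⊕ scale u (a ⊛ A))
        ≈⟨ scale-distribˡ u (a ⊛ p) (scale u (a ⊛ A)) ⟩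
      scale u (a ⊛ p) ⊕ scale u (scale u (a ⊛ A))
        ≈⟨ ⊕-cong ≃-refl (≃-trans (scale-assoc u u (a ⊛ A)) (scale-zero (a ⊛ A) u²≈0)) ⟩
      scale u (a ⊛ p) ⊕ []
        ≈⟨ ⊕-identityʳ (scale u (a ⊛ p)) ⟩
      scale u (a ⊛ p) ∎

    taylor : ∀ a p → (p ∘ₚ (X ⊕ scale u a)) ≃ (p ⊕ scale u (a ⊛ deriv p))
    taylor a [] = ≃-sym (scale-cong refl (⊛-zeroʳ a))
    taylor a (b ∷ p) = begin
      (b ∷ []) ⊕ (G ⊛ (p ∘ₚ G))
        ≈⟨ ⊕-cong ≃-refl (≃-trans (⊛-congʳ G (taylor a p)) G⊛Q) ⟩
      (b ∷ []) ⊕ ((0# ∷ Q) ⊕ scale u (a ⊛ p))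
        ≈⟨ ⊕-assoc (b ∷ []) (0# ∷ Q) (scale u (a ⊛ p)) ⟨
      ((b ∷ p) ⊕ (0# ∷ scale u A)) ⊕ scale u (a ⊛ p)
        ≈⟨ ⊕-assoc (b ∷ p) (0# ∷ scale u A) (scale u (a ⊛ p)) ⟩
      (b ∷ p) ⊕ ((0# ∷ scale u A) ⊕ scale u (a ⊛ p))
        ≈⟨ ⊕-cong ≃-refl (≃-trans (⊕-comm (0# ∷ scale u A) (scale u (a ⊛ p))) derivative-term) ⟩
      (b ∷ p) ⊕ scale u (a ⊛ deriv (b ∷ p)) ∎
      where
      G = X ⊕ scale u a
      A = a ⊛ deriv p
      Q = p ⊕ scale u A

      -- Multiplication by T + u·a, discarding the u²-term.
      G⊛Q : (G ⊛ Q) ≃ ((0# ∷ Q) ⊕ scale u (a ⊛ p))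
      G⊛Q = ≃-trans (⊛-distribʳ X (scale u a) Q)
              (⊕-cong (⊛-X Q) (≃-trans (⊛-scaleˡ u a Q) (absorb a p A)))

      derivative-term : (scale u (a ⊛ p) ⊕ (0# ∷ scale u A)) ≃ scale u (a ⊛ deriv (b ∷ p))
      derivative-term = begin
        scale u (a ⊛ p) ⊕ (0# ∷ scale u A)
          ≈⟨ ⊕-cong ≃-refl (shift-scale u A) ⟨
        scale u (a ⊛ p) ⊕ scale u (0# ∷ A)
          ≈⟨ scale-distribˡ u (a ⊛ p) (0# ∷ A) ⟨
        scale u ((a ⊛ p) ⊕ (0# ∷ A))
          ≈⟨ scale-cong refl (≃-trans (⊛-distribˡ a p (0# ∷ deriv p))
                                      (⊕-cong ≃-refl (⊛-shift a (deriv p)))) ⟨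
        scale u (a ⊛ deriv (b ∷ p)) ∎

    -- Conjugating T + u·a by f gives T + u·((a·f') ∘ f⁻¹), which is linear in a.
    Ad-T+u· : ∀ f finv → (f ∘ₚ finv) ≃ X → ∀ a →
              Ad f finv (X ⊕ scale u a) ≃ (X ⊕ scale u ((a ⊛ deriv f) ∘ₚ finv))
    Ad-T+u· f finv f∘finv≃X a = begin
      (f ∘ₚ (X ⊕ scale u a)) ∘ₚ finv
        ≈⟨ ∘-congˡ finv (taylor a f) ⟩
      (f ⊕ scale u (a ⊛ deriv f)) ∘ₚ finv
        ≈⟨ ∘-distrib f (scale u (a ⊛ deriv f)) finv ⟩
      (f ∘ₚ finv) ⊕ (scale u (a ⊛ deriv f) ∘ₚ finv)
        ≈⟨ ⊕-cong f∘finv≃X (∘-scale u (a ⊛ deriv f) finv) ⟩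
      X ⊕ scale u ((a ⊛ deriv f) ∘ₚ finv) ∎

    Ad-scale : ∀ f finv → (f ∘ₚ finv) ≃ X → ∀ g h h' k →
               g ≃ (X ⊕ scale u h) → Ad f finv g ≃ (X ⊕ scale u h') →
               Ad f finv (X ⊕ scale u (scale k h)) ≃ (X ⊕ scale u (scale k h'))
    Ad-scale f finv f∘finv≃X g h h' k g≃T+uh Adg≃T+uh' = begin
      Ad f finv (X ⊕ scale u (scale k h))
        ≈⟨ Ad-T+u· f finv f∘finv≃X (scale k h) ⟩
      X ⊕ scale u ((scale k h ⊛ deriv f) ∘ₚ finv)
        ≈⟨ ⊕-cong ≃-refl (scale-cong refl (≃-trans (∘-congˡ finv (⊛-scaleˡ k h (deriv f)))
                                                   (∘-scale k (h ⊛ deriv f) finv))) ⟩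
      X ⊕ scale u (scale k H)
        ≈⟨ ⊕-cong ≃-refl (scale-comm u k H) ⟩
      X ⊕ scale k (scale u H)
        ≈⟨ ⊕-cong ≃-refl (scale-cong refl uH≃uh') ⟩
      X ⊕ scale k (scale u h')
        ≈⟨ ⊕-cong ≃-refl (scale-comm k u h') ⟩
      X ⊕ scale u (scale k h') ∎
      where
      H = (h ⊛ deriv f) ∘ₚ finv

      -- Comparing the two descriptions of Ad_f(g) and cancelling T.
      uH≃uh' : scale u H ≃ scale u h'
      uH≃uh' = ⊕-cancelˡ X (scale u H) (scale u h') (begin
        X ⊕ scale u H                  ≈⟨ Ad-T+u· f finv f∘finv≃X h ⟨
        Ad f finv (X ⊕ scale u h)      ≈⟨ ∘-congˡ finv (∘-congʳ f g≃T+uh) ⟨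
        Ad f finv g                    ≈⟨ Adg≃T+uh' ⟩
        X ⊕ scale u h'                 ∎)

module Powers {c ℓ} (R : CommutativeRing c ℓ) where
  open Poly R using (pow; Divides; _≈_; _*_; sym; trans; *-congˡ; *-assoc; *-identityˡ)

  pow-+ : ∀ a i j → pow a (i +ℕ j) ≈ pow a i * pow a j
  pow-+ a zero j = sym (*-identityˡ (pow a j))
  pow-+ a (suc i) j = trans (*-congˡ (pow-+ a i j)) (sym (*-assoc a (pow a i) (pow a j)))

  pow-divides : ∀ a {i j} → i ≤ j → Divides (pow a i) (pow a j)
  pow-divides a {i} i≤j with m≤n⇒∃[o]m+o≡n i≤j
  ... | o , ≡-refl = pow a o , sym (pow-+ a i o)

-- Theorem 5.2: instantiate the scaling statement with R/qⁿ and u = q^r, which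
-- is square-zero in R/qⁿ since n ≤ 2r.
theorem5p2 : ∀ {c ℓ} (R : CommutativeRing c ℓ) → let open Poly R in
    (q : Carrier) → TorsionFree q → PrimePrincipal q →
    (n r : ℕ) → n <ℕ r +ℕ r →
    (f finv : Pol) → (f ∘ₚ finv) ≡[mod pow q n ] X → (finv ∘ₚ f) ≡[mod pow q n ] X →
    (g h : Pol) → InK q n r g h →
    (k : Carrier) →
    (h' : Pol) → ((f ∘ₚ g) ∘ₚ finv) ≡[mod pow q n ] TplusQr q r h' →
    ((f ∘ₚ smul q r k h) ∘ₚ finv) ≡[mod pow q n ] smul q r k h'
theorem5p2 R q _ _ n r n<2r f finv f∘finv≡X _ g h (_ , g≡T+q^rh) k h' Adg≡T+q^rh' =
  coeff-≈ (Ad-scale f finv (coeffwise f∘finv≡X) g h h' k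
                    (coeffwise g≡T+q^rh) (coeffwise Adg≡T+q^rh'))
  where
  open Poly R using (pow; _*_; 0#)
  open Powers R using (pow-+; pow-divides)
  open Modulo R (pow q n) using (_≋_; mR-resp; mR⇒≋0; ≋-isRingCongruence)
  open PolynomialsModulo R ≋-isRingCongruence using (coeffwise; coeff-≈; module SquareZero)

  q^r-square-zero : pow q r * pow q r ≋ 0#
  q^r-square-zero = mR⇒≋0 (mR-resp (pow-+ q r r) (pow-divides q (<⇒≤ n<2r)))

  open SquareZero (pow q r) q^r-square-zero using (Ad-scale)
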